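{- There is a bijection between RL-minima of $\sigma$ and dotted boxes in $T$ at height $0$ with a right border equal to $U$.
   Context: Let $T$ be a Dyck tableau of size $n$ and $\sigma=\phi(T)$. A Dyck tableau of size $n$ is a Dyck path of size $n$ (the staircase Ferrers diagram $E_n=(n,\dots,1)$ with the boxes of a partition $\mu\subset E_{n-1}$ removed, with $n$ columns) in which each column contains exactly one dot. The tableau $T$ with $\phi(T)=\sigma$ is constructed from $\sigma$: label the columns of a basement from left to right by $\sigma(1),\dots,\sigma(n)$ and, for $j=1,\dots,n$, insert a dotted box in the column labeled $j$ and, if it is to the left of the dotted box added at step $j-1$, add a ribbon between these two boxes (a strip of boxes along the lower border linking the two dots, raising by one box the columns strictly between them). The height of a dot is the number of empty boxes above it in its column. The right border of a column is the right one of the two steps of the lower border at the bottom of that column ($D$ for a down step, $U$ for an up step). An entry $j=\sigma(i)$ is a right-to-left minimum (RL-minimum) if $\sigma(i)<\sigma(i')$ for all $i'>i$. -}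

module Defs where

open import Level using (0ℓ)
open import Data.Nat as ℕ using (ℕ; zero; suc; _+_; _*_; _≤ᵇ_; _<ᵇ_)
open import Data.Integer as ℤ using (ℤ; +_; -[1+_])
open import Data.Fin as Fin using (Fin; toℕ)
open import Data.Fin.Permutation using (Permutation′; _⟨$⟩ʳ_; _⟨$⟩ˡ_)
open import Data.Bool using (Bool; true; false; if_then_else_; _∧_)
open import Data.List using (List; []; _∷_; map)
open import Data.List using () renaming (allFin to allFinL)
open import Data.Maybe using (Maybe; just; nothing)
open import Data.Product using (Σ; proj₁)
open import Relation.Nullary using (does)
open import Relation.Binary using (Setoid)
open import Relation.Binary.PropositionalEquality as ≡ using (_≡_)
import Relation.Binary.Construct.On as On

-- The basement is a horizontal line at the top; the tableau hangs below
-- it.  Columns are numbered 0,…,n-1 from left to right; column c occupies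
-- the abscissae [2c, 2c+2].  The lower border is described by its depth
-- (distance below the basement) at each integer abscissa x ∈ [0, 2n];
-- consecutive depths differ by ±1.  Column c has its bottom point at
-- abscissa 2c+1, and the two steps of the lower border at the bottom of
-- column c are the steps 2c → 2c+1 (left) and 2c+1 → 2c+2 (right).
-- A step that brings the border closer to the basement (depth decreases)
-- is an up step U, otherwise a down step D.
--
-- Before anything is inserted, every (still empty) column is a virtual
-- "peak" of depth -1 at its middle (so that inserting the first box of
-- a column gives it the usual bottom D U with depth 1 in the middle).

data Step : Set where
  U D : Step

record Tableau : Set where
  field
    border    : ℕ → ℤ   -- depth of the lower border at abscissa x
    boxes     : ℕ → ℕ
    dotHeight : ℕ → ℕ   -- number of (empty) boxes above the dot of column c
open Tableau public

initBorder : ℕ → ℤ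
initBorder zero          = + 0
initBorder (suc zero)    = -[1+ 0 ]
initBorder (suc (suc x)) = initBorder x

emptyTableau : Tableau
emptyTableau = record
  { border    = initBorder
  ; boxes     = λ _ → 0
  ; dotHeight = λ _ → 0
  }

insertDot : ℕ → Tableau → Tableau
insertDot p T = record
  { border    = λ x → if does (x ℕ.≟ (2 * p + 1))
                        then border T x ℤ.+ + 2 else border T x
  ; boxes     = λ c → if does (c ℕ.≟ p) then suc (boxes T c) else boxes T c
  ; dotHeight = λ c → if does (c ℕ.≟ p) then boxes T p else dotHeight T c
  }

-- add a ribbon along the lower border between the dots of columns p < q:
-- every column strictly between p and q is raised (lengthened) by one box,
-- i.e. the lower border over the abscissae [2p+2, 2q] goes down by one box.
addRibbon : ℕ → ℕ → Tableau → Tableau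
addRibbon p q T = record
  { border    = λ x → if ((2 * p + 2) ≤ᵇ x) ∧ (x ≤ᵇ (2 * q))
                        then border T x ℤ.+ + 2 else border T x
  ; boxes     = λ c → if (p <ᵇ c) ∧ (c <ᵇ q) then suc (boxes T c) else boxes T c
  ; dotHeight = dotHeight T
  }

insertStep : Maybe ℕ → ℕ → Tableau → Tableau
insertStep nothing  p T = insertDot p T
insertStep (just q) p T =
  if p <ᵇ q then addRibbon p q (insertDot p T) else insertDot p T

runSteps : Maybe ℕ → List ℕ → Tableau → Tableau
runSteps prev []       T = T
runSteps prev (p ∷ ps) T = runSteps (just p) ps (insertStep prev p T)

-- Labels and positions are 0-based:
-- the column at position i carries the label σ(i); at step j (j = 0,…,n-1)
-- we insert in the column labelled j, i.e. in column σ⁻¹(j).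
φ⁻¹ : ∀ {n} → Permutation′ n → Tableau
φ⁻¹ {n} σ = runSteps nothing (map (λ j → toℕ (σ ⟨$⟩ˡ j)) (allFinL n)) emptyTableau

height : ∀ {n} → Tableau → Fin n → ℕ
height T i = dotHeight T (toℕ i)

rightBorder : ∀ {n} → Tableau → Fin n → Step
rightBorder T i =
  if does (border T (2 * toℕ i + 2) ℤ.<? border T (2 * toℕ i + 1)) then U else D

RLmin : ∀ {n} → Permutation′ n → Fin n → Set
RLmin {n} σ i = ∀ (i′ : Fin n) → i Fin.< i′ → σ ⟨$⟩ʳ i Fin.< σ ⟨$⟩ʳ i′

-- the subset {i | P i} of Fin n, as a setoid (elements compared by index)
SubsetOf : ∀ {n} → (Fin n → Set) → Setoid 0ℓ 0ℓ
SubsetOf {n} P = On.setoid {B = Σ (Fin n) P} (≡.setoid (Fin n)) proj₁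

-- Let c be the column at position i; its label is σ(i), so its dot is inserted at step σ(i).
-- Before that step column c is empty, and only a ribbon between consecutively inserted dots
-- p < q with p < c < q can give it a box.  When its dot arrives it lands on top of these boxes,
-- and its right step becomes U unless the dot inserted just before lies to the right of c, in
-- which case the ribbon starting at c turns that step back into D.  Later steps touch neither
-- the dot nor the right step of column c.  Hence the dot has height 0 and right border U exactly
-- when every smaller label sits to the left of c, i.e. when σ(i) is a right-to-left minimum, and
-- the bijection is the identity on positions.
module Submission where

open import Defs
open import Data.Nat using (ℕ)
open import Data.Fin using (Fin)
open import Data.Fin.Permutation using (Permutation′)
open import Data.Product using (_×_)
open import Relation.Binary.PropositionalEquality using (_≡_)
open import Function.Bundles using (Bijection)

open import Data.Bool using (true; false; _∧_; if_then_else_)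
open import Data.Bool.Properties using (∧-zeroʳ)
open import Data.Fin as Fin using (toℕ)
import Data.Fin.Properties as Fin
open import Data.Fin.Permutation using (_⟨$⟩ʳ_; _⟨$⟩ˡ_; inverseˡ; inverseʳ)
open import Data.Integer as ℤ using (ℤ; +_; 1ℤ; -1ℤ)
import Data.Integer.Properties as ℤ
open import Algebra.Properties.CommutativeSemigroup ℤ.+-commutativeSemigroup using (xy∙z≈xz∙y)
open import Data.List using (List; []; _∷_; _++_; map; tabulate; allFin)
open import Data.List.Properties using (map-tabulate)
open import Data.List.Relation.Unary.All using (All; []; _∷_)
open import Data.List.Relation.Unary.All.Properties using (tabulate⁺)
open import Data.Maybe using (Maybe; just; nothing)
import Data.Maybe.Relation.Unary.All as Maybe
open import Data.Nat
  using (zero; suc; _+_; _*_; _≤_; _<_; _<ᵇ_; _≟_; _≤?_; _<?_; z<s; s<s; s<s⁻¹; s≤s⁻¹)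
open import Data.Nat.Properties
open import Data.Product using (_,_; proj₁; proj₂)
open import Data.Product.Function.NonDependent.Propositional using (_×-⇔_)
open import Function using (_∘_; id)
open import Function.Bundles using (_⇔_; mk⇔; Equivalence)
import Function.Properties.Equivalence as ⇔
open import Relation.Binary.Definitions using (tri<; tri≈; tri>)
open import Relation.Binary.PropositionalEquality
  using (_≢_; refl; sym; trans; cong; subst; module ≡-Reasoning)
open import Relation.Nullary using (¬_; yes; no; contradiction)
open import Relation.Nullary.Decidable using (dec-true; dec-false; does-⇔)

double-suc : ∀ n → 2 * suc n ≡ 2 * n + 2
double-suc n = trans (*-suc 2 n) (+-comm 2 (2 * n))

double-<⇒ : ∀ {m n} → m < n → 2 * m + 2 ≤ 2 * n
double-<⇒ {m} {n} m<n = subst (_≤ 2 * n) (double-suc m) (*-monoʳ-≤ 2 m<n)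

-- x is an end of the right step of column c, which runs from abscissa 2c+1 to 2c+2.
module RightStep {c x : ℕ} (lo : 2 * c + 1 ≤ x) (hi : x ≤ 2 * c + 2) where
  open ≤-Reasoning

  x≡2p+1⇒p≡c : ∀ {p} → x ≡ 2 * p + 1 → p ≡ c
  x≡2p+1⇒p≡c {p} refl = ≤-antisym p≤c c≤p
    where
    c≤p : c ≤ p
    c≤p = *-cancelˡ-≤ 2 (+-cancelʳ-≤ 1 _ _ lo)
    p≤c : p ≤ c
    p≤c = s≤s⁻¹ (*-cancelˡ-< 2 p (suc c) (begin-strict
      2 * p      <⟨ m<m+n (2 * p) z<s ⟩
      2 * p + 1  ≤⟨ hi ⟩
      2 * c + 2  ≡⟨ double-suc c ⟨
      2 * suc c  ∎))

  2p+2≤x⇔p<c : ∀ {p} → p ≢ c → 2 * p + 2 ≤ x ⇔ p < c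
  2p+2≤x⇔p<c {p} p≢c = mk⇔ to from
    where
    to : 2 * p + 2 ≤ x → p < c
    to h = ≤∧≢⇒< (*-cancelˡ-≤ 2 (+-cancelʳ-≤ 2 _ _ (≤-trans h hi))) p≢c
    from : p < c → 2 * p + 2 ≤ x
    from p<c = begin
      2 * p + 2  ≤⟨ double-<⇒ p<c ⟩
      2 * c      ≤⟨ m≤m+n (2 * c) 1 ⟩
      2 * c + 1  ≤⟨ lo ⟩
      x          ∎

  x≤2q⇔c<q : ∀ q → x ≤ 2 * q ⇔ c < q
  x≤2q⇔c<q q = mk⇔ to from
    where
    to : x ≤ 2 * q → c < q
    to h = *-cancelˡ-< 2 c q (begin-strict
      2 * c      <⟨ m<m+n (2 * c) z<s ⟩
      2 * c + 1  ≤⟨ lo ⟩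
      x          ≤⟨ h ⟩
      2 * q      ∎)
    from : c < q → x ≤ 2 * q
    from c<q = ≤-trans hi (double-<⇒ c<q)

  border-insertDot : ∀ {p} T → p ≢ c → border (insertDot p T) x ≡ border T x
  border-insertDot {p} T p≢c rewrite dec-false (x ≟ 2 * p + 1) (p≢c ∘ x≡2p+1⇒p≡c) = refl

  border-addRibbon : ∀ {p} q T → p ≢ c →
    border (addRibbon p q T) x ≡ (if (p <ᵇ c) ∧ (c <ᵇ q) then border T x ℤ.+ + 2 else border T x)
  border-addRibbon {p} q T p≢c
    rewrite does-⇔ (2p+2≤x⇔p<c p≢c) (2 * p + 2 ≤? x) (p <? c)
          | does-⇔ (x≤2q⇔c<q q) (x ≤? 2 * q) (c <? q) = refl

module Bottom (c : ℕ) = RightStep {c} {2 * c + 1} ≤-refl (+-monoʳ-≤ (2 * c) (n≤1+n 1))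
module Corner (c : ℕ) = RightStep {c} {2 * c + 2} (+-monoʳ-≤ (2 * c) (n≤1+n 1)) ≤-refl

-- Borders are depths below the basement, so k = 1 is an up step U and k = -1 a down step D.
record RightGap (T : Tableau) (c : ℕ) (k : ℤ) : Set where
  constructor rightGap
  field bottom≡ : border T (2 * c + 1) ≡ k ℤ.+ border T (2 * c + 2)
open RightGap

Rises : Tableau → ℕ → Set
Rises T c = border T (2 * c + 2) ℤ.< border T (2 * c + 1)

gap+1⇒rises : ∀ {T c} → RightGap T c 1ℤ → Rises T c
gap+1⇒rises gap = ℤ.suc[i]≤j⇒i<j (ℤ.≤-reflexive (sym (bottom≡ gap)))

gap-1⇒¬rises : ∀ {T c} → RightGap T c -1ℤ → ¬ Rises T c
gap-1⇒¬rises {T} {c} gap =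
  ℤ.<-asym (subst (ℤ._< border T (2 * c + 2)) (sym (bottom≡ gap)) (ℤ.i≤pred[j]⇒i<j ℤ.≤-refl))

rightBorder≡U⇔rises : ∀ {n} T (i : Fin n) → rightBorder T i ≡ U ⇔ Rises T (toℕ i)
rightBorder≡U⇔rises T i with border T (2 * toℕ i + 2) ℤ.<? border T (2 * toℕ i + 1)
... | yes rises = mk⇔ (λ _ → rises) (λ _ → refl)
... | no ¬rises = mk⇔ (λ ()) (λ rises → contradiction rises ¬rises)

module _ {p c : ℕ} (T : Tableau) where

  boxes-insertDot-other : p ≢ c → boxes (insertDot p T) c ≡ boxes T c
  boxes-insertDot-other p≢c rewrite dec-false (c ≟ p) (p≢c ∘ sym) = refl

  dotHeight-insertDot-other : p ≢ c → dotHeight (insertDot p T) c ≡ dotHeight T c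
  dotHeight-insertDot-other p≢c rewrite dec-false (c ≟ p) (p≢c ∘ sym) = refl

  rightGap-insertDot-other : ∀ {k} → p ≢ c → RightGap T c k → RightGap (insertDot p T) c k
  bottom≡ (rightGap-insertDot-other p≢c gap)
    rewrite Bottom.border-insertDot c T p≢c | Corner.border-insertDot c T p≢c = bottom≡ gap

  boxes-addRibbon-≥ : ∀ q → boxes T c ≤ boxes (addRibbon p q T) c
  boxes-addRibbon-≥ q with (p <ᵇ c) ∧ (c <ᵇ q)
  ... | true  = n≤1+n _
  ... | false = ≤-refl

  boxes-addRibbon-over : ∀ {q} → p < c → c < q → boxes (addRibbon p q T) c ≡ suc (boxes T c)
  boxes-addRibbon-over {q} p<c c<q rewrite dec-true (p <? c) p<c | dec-true (c <? q) c<q = refl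

  boxes-addRibbon-beyond : ∀ {q} → ¬ c < q → boxes (addRibbon p q T) c ≡ boxes T c
  boxes-addRibbon-beyond {q} c≮q rewrite dec-false (c <? q) c≮q | ∧-zeroʳ (p <ᵇ c) = refl

  rightGap-addRibbon-other : ∀ q {k} → p ≢ c → RightGap T c k → RightGap (addRibbon p q T) c k
  bottom≡ (rightGap-addRibbon-other q {k} p≢c gap)
    rewrite Bottom.border-addRibbon c q T p≢c | Corner.border-addRibbon c q T p≢c
    with (p <ᵇ c) ∧ (c <ᵇ q)
  ... | true  = trans (cong (ℤ._+ + 2) (bottom≡ gap)) (ℤ.+-assoc k _ (+ 2))
  ... | false = bottom≡ gap

module _ (c : ℕ) (T : Tableau) where

  dotHeight-insertDot-own : dotHeight (insertDot c T) c ≡ boxes T c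
  dotHeight-insertDot-own rewrite dec-true (c ≟ c) refl = refl

  border-insertDot-own-bottom : border (insertDot c T) (2 * c + 1) ≡ border T (2 * c + 1) ℤ.+ + 2
  border-insertDot-own-bottom rewrite dec-true (2 * c + 1 ≟ 2 * c + 1) refl = refl

  border-insertDot-own-corner : border (insertDot c T) (2 * c + 2) ≡ border T (2 * c + 2)
  border-insertDot-own-corner
    rewrite dec-false (2 * c + 2 ≟ 2 * c + 1) ((λ ()) ∘ +-cancelˡ-≡ (2 * c) 2 1) = refl

  border-addRibbon-own-bottom : ∀ q → border (addRibbon c q T) (2 * c + 1) ≡ border T (2 * c + 1)
  border-addRibbon-own-bottom q
    rewrite dec-false (2 * c + 2 ≤? 2 * c + 1) (<⇒≱ (+-monoʳ-< (2 * c) (n<1+n 1))) = refl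

  border-addRibbon-own-corner : ∀ {q} → c < q →
    border (addRibbon c q T) (2 * c + 2) ≡ border T (2 * c + 2) ℤ.+ + 2
  border-addRibbon-own-corner {q} c<q
    rewrite dec-true (2 * c + 2 ≤? 2 * c + 2) ≤-refl
          | dec-true (2 * c + 2 ≤? 2 * q) (double-<⇒ c<q) = refl

module _ {p c : ℕ} where

  dotHeight-insertStep-other : ∀ prev T → p ≢ c → dotHeight (insertStep prev p T) c ≡ dotHeight T c
  dotHeight-insertStep-other nothing T p≢c = dotHeight-insertDot-other T p≢c
  dotHeight-insertStep-other (just q) T p≢c with p <ᵇ q
  ... | true  = dotHeight-insertDot-other T p≢c
  ... | false = dotHeight-insertDot-other T p≢c

  rightGap-insertStep-other : ∀ prev T {k} → p ≢ c → RightGap T c k →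
                              RightGap (insertStep prev p T) c k
  rightGap-insertStep-other nothing T p≢c gap = rightGap-insertDot-other T p≢c gap
  rightGap-insertStep-other (just q) T p≢c gap with p <ᵇ q
  ... | true  = rightGap-addRibbon-other (insertDot p T) q p≢c (rightGap-insertDot-other T p≢c gap)
  ... | false = rightGap-insertDot-other T p≢c gap

  boxes-insertStep-≥ : ∀ prev T → p ≢ c → boxes T c ≤ boxes (insertStep prev p T) c
  boxes-insertStep-≥ nothing T p≢c = ≤-reflexive (sym (boxes-insertDot-other T p≢c))
  boxes-insertStep-≥ (just q) T p≢c with p <ᵇ q
  ... | true  = ≤-trans (≤-reflexive (sym (boxes-insertDot-other T p≢c)))
                        (boxes-addRibbon-≥ (insertDot p T) q)
  ... | false = ≤-reflexive (sym (boxes-insertDot-other T p≢c))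

  boxes-insertStep-over : ∀ {q} T → p < c → c < q →
                          boxes (insertStep (just q) p T) c ≡ suc (boxes T c)
  boxes-insertStep-over {q} T p<c c<q rewrite dec-true (p <? q) (<-trans p<c c<q) =
    trans (boxes-addRibbon-over (insertDot p T) p<c c<q) (cong suc (boxes-insertDot-other T (<⇒≢ p<c)))

  boxes-insertStep-unchanged : ∀ prev T → Maybe.All (_≤ c) prev → p ≢ c →
                               boxes (insertStep prev p T) c ≡ boxes T c
  boxes-insertStep-unchanged nothing T _ p≢c = boxes-insertDot-other T p≢c
  boxes-insertStep-unchanged (just q) T (Maybe.just q≤c) p≢c with p <ᵇ q
  ... | true  = trans (boxes-addRibbon-beyond (insertDot p T) (≤⇒≯ q≤c)) (boxes-insertDot-other T p≢c)
  ... | false = boxes-insertDot-other T p≢c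

module _ {c : ℕ} where

  dotHeight-insertStep-own : ∀ prev T → dotHeight (insertStep prev c T) c ≡ boxes T c
  dotHeight-insertStep-own nothing T = dotHeight-insertDot-own c T
  dotHeight-insertStep-own (just q) T with c <ᵇ q
  ... | true  = dotHeight-insertDot-own c T
  ... | false = dotHeight-insertDot-own c T

  rightGap-insertDot-own : ∀ T {k} → RightGap T c k → RightGap (insertDot c T) c (k ℤ.+ + 2)
  bottom≡ (rightGap-insertDot-own T {k} gap)
    rewrite border-insertDot-own-bottom c T | border-insertDot-own-corner c T =
      trans (cong (ℤ._+ + 2) (bottom≡ gap)) (xy∙z≈xz∙y k _ (+ 2))

  rightGap-insertStep-own-up : ∀ prev T {k} → Maybe.All (_≤ c) prev → RightGap T c k →
                               RightGap (insertStep prev c T) c (k ℤ.+ + 2)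
  rightGap-insertStep-own-up nothing T _ gap = rightGap-insertDot-own T gap
  rightGap-insertStep-own-up (just q) T (Maybe.just q≤c) gap
    rewrite dec-false (c <? q) (≤⇒≯ q≤c) = rightGap-insertDot-own T gap

  rightGap-insertStep-own-ribbon : ∀ {q} T {k} → c < q → RightGap T c k →
                                   RightGap (insertStep (just q) c T) c k
  bottom≡ (rightGap-insertStep-own-ribbon {q} T {k} c<q gap)
    rewrite dec-true (c <? q) c<q
          | border-addRibbon-own-bottom c (insertDot c T) q
          | border-addRibbon-own-corner c (insertDot c T) c<q
          | border-insertDot-own-bottom c T | border-insertDot-own-corner c T =
      trans (cong (ℤ._+ + 2) (bottom≡ gap)) (ℤ.+-assoc k _ (+ 2))

lastInserted : Maybe ℕ → List ℕ → Maybe ℕ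
lastInserted prev []       = prev
lastInserted prev (p ∷ ps) = lastInserted (just p) ps

runSteps-++ : ∀ prev xs ys T →
  runSteps prev (xs ++ ys) T ≡ runSteps (lastInserted prev xs) ys (runSteps prev xs T)
runSteps-++ prev []       ys T = refl
runSteps-++ prev (x ∷ xs) ys T = runSteps-++ (just x) xs ys (insertStep prev x T)

-- Inserting the dot of column c into T right after the dot of column prev gives it height 0
-- and an up right step exactly when T is ready for c.
Ready : ℕ → Maybe ℕ → Tableau → Set
Ready c prev T = boxes T c ≡ 0 × Maybe.All (_≤ c) prev

module _ {c : ℕ} where

  dotHeight-runSteps-other : ∀ prev ys T → All (_≢ c) ys →
                             dotHeight (runSteps prev ys T) c ≡ dotHeight T c
  dotHeight-runSteps-other prev []       T []           = refl
  dotHeight-runSteps-other prev (y ∷ ys) T (y≢c ∷ ys≢c) =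
    trans (dotHeight-runSteps-other (just y) ys (insertStep prev y T) ys≢c)
          (dotHeight-insertStep-other prev T y≢c)

  rightGap-runSteps-other : ∀ prev ys T {k} → All (_≢ c) ys → RightGap T c k →
                            RightGap (runSteps prev ys T) c k
  rightGap-runSteps-other prev []       T []           gap = gap
  rightGap-runSteps-other prev (y ∷ ys) T (y≢c ∷ ys≢c) gap =
    rightGap-runSteps-other (just y) ys (insertStep prev y T) ys≢c
                            (rightGap-insertStep-other prev T y≢c gap)

  -- A ribbon from x < c back to a previous dot q > c would have put a box in column c.
  empty⇒previous≤ : ∀ prev T {x} → x < c → boxes (insertStep prev x T) c ≡ 0 →
                    Maybe.All (_≤ c) prev
  empty⇒previous≤ nothing  T x<c empty = Maybe.nothing
  empty⇒previous≤ (just q) T x<c empty with q ≤? c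
  ... | yes q≤c = Maybe.just q≤c
  ... | no  q≰c = contradiction (trans (sym (boxes-insertStep-over T x<c (≰⇒> q≰c))) empty) λ ()

  ready-insertStep : ∀ prev T {x} → x ≢ c →
                     Ready c (just x) (insertStep prev x T) ⇔ (Ready c prev T × x < c)
  ready-insertStep prev T {x} x≢c = mk⇔ to from
    where
    to : Ready c (just x) (insertStep prev x T) → Ready c prev T × x < c
    to (empty , Maybe.just x≤c) = (empty-before , empty⇒previous≤ prev T x<c empty) , x<c
      where
      x<c : x < c
      x<c = ≤∧≢⇒< x≤c x≢c
      empty-before : boxes T c ≡ 0
      empty-before = n≤0⇒n≡0 (subst (boxes T c ≤_) empty (boxes-insertStep-≥ prev T x≢c))
    from : Ready c prev T × x < c → Ready c (just x) (insertStep prev x T)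
    from ((empty , previous) , x<c) =
      trans (boxes-insertStep-unchanged prev T previous x≢c) empty , Maybe.just (<⇒≤ x<c)

  ready-runSteps : ∀ prev xs T → All (_≢ c) xs →
                   Ready c (lastInserted prev xs) (runSteps prev xs T) ⇔ (Ready c prev T × All (_< c) xs)
  ready-runSteps prev []       T []           = mk⇔ (_, []) proj₁
  ready-runSteps prev (x ∷ xs) T (x≢c ∷ xs≢c) = mk⇔ to from
    where
    module First = Equivalence (ready-insertStep prev T x≢c)
    module Rest = Equivalence (ready-runSteps (just x) xs (insertStep prev x T) xs≢c)
    Final : Set
    Final = Ready c (lastInserted (just x) xs) (runSteps (just x) xs (insertStep prev x T))
    to : Final → Ready c prev T × All (_< c) (x ∷ xs)
    to ready with Rest.to ready
    ... | ready′ , xs<c with First.to ready′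
    ...   | ready″ , x<c = ready″ , x<c ∷ xs<c
    from : Ready c prev T × All (_< c) (x ∷ xs) → Final
    from (ready , x<c ∷ xs<c) = Rest.from (First.from (ready , x<c) , xs<c)

initBorder-periodic : ∀ m r → initBorder (2 * m + r) ≡ initBorder r
initBorder-periodic zero    r = refl
initBorder-periodic (suc m) r = begin
  initBorder (2 * suc m + r)    ≡⟨ cong (λ x → initBorder (x + r)) (*-suc 2 m) ⟩
  initBorder (2 + 2 * m + r)    ≡⟨ cong initBorder (+-assoc 2 (2 * m) r) ⟩
  initBorder (2 + (2 * m + r))  ≡⟨ initBorder-periodic m r ⟩
  initBorder r                  ∎
  where open ≡-Reasoning

rightGap-empty : ∀ c → RightGap emptyTableau c -1ℤ
bottom≡ (rightGap-empty c) =
  trans (initBorder-periodic c 1) (cong (λ b → -1ℤ ℤ.+ b) (sym (initBorder-periodic c 2)))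

GroundedUp : Tableau → ℕ → Set
GroundedUp T c = dotHeight T c ≡ 0 × Rises T c

module _ {c : ℕ} {ys : List ℕ} (ys≢c : All (_≢ c) ys) where

  rises⇒previous≤ : ∀ prev T → RightGap T c -1ℤ → Rises (runSteps prev (c ∷ ys) T) c →
                    Maybe.All (_≤ c) prev
  rises⇒previous≤ nothing  T gap rises = Maybe.nothing
  rises⇒previous≤ (just q) T gap rises with q ≤? c
  ... | yes q≤c = Maybe.just q≤c
  ... | no  q≰c = contradiction rises (gap-1⇒¬rises
        (rightGap-runSteps-other (just c) ys _ ys≢c (rightGap-insertStep-own-ribbon T (≰⇒> q≰c) gap)))

  groundedUp⇔ready : ∀ prev T → RightGap T c -1ℤ →
                     GroundedUp (runSteps prev (c ∷ ys) T) c ⇔ Ready c prev T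
  groundedUp⇔ready prev T gap = mk⇔ to from
    where
    dotHeight≡boxes : dotHeight (runSteps prev (c ∷ ys) T) c ≡ boxes T c
    dotHeight≡boxes = trans (dotHeight-runSteps-other (just c) ys _ ys≢c) (dotHeight-insertStep-own prev T)
    to : GroundedUp (runSteps prev (c ∷ ys) T) c → Ready c prev T
    to (height0 , rises) = trans (sym dotHeight≡boxes) height0 , rises⇒previous≤ prev T gap rises
    from : Ready c prev T → GroundedUp (runSteps prev (c ∷ ys) T) c
    from (empty , previous) = trans dotHeight≡boxes empty ,
      gap+1⇒rises (rightGap-runSteps-other (just c) ys _ ys≢c
                                              (rightGap-insertStep-own-up prev T previous gap))

  groundedUp⇔left-of : ∀ {xs} → All (_≢ c) xs →
    GroundedUp (runSteps nothing (xs ++ c ∷ ys) emptyTableau) c ⇔ All (_< c) xs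
  groundedUp⇔left-of {xs} xs≢c rewrite runSteps-++ nothing xs (c ∷ ys) emptyTableau =
    ⇔.trans (groundedUp⇔ready _ _ gap)
      (⇔.trans (ready-runSteps nothing xs emptyTableau xs≢c) (mk⇔ proj₂ ((refl , Maybe.nothing) ,_)))
    where
    gap : RightGap (runSteps nothing xs emptyTableau) c -1ℤ
    gap = rightGap-runSteps-other nothing xs emptyTableau xs≢c (rightGap-empty c)

record Split {A : Set} {n : ℕ} (f : Fin n → A) (j : Fin n) : Set₁ where
  field
    before after : List A
    tabulate≡    : tabulate f ≡ before ++ f j ∷ after
    All-before   : ∀ {P : A → Set} → All P before ⇔ (∀ k → k Fin.< j → P (f k))
    All-after    : ∀ {P : A → Set} → (∀ k → j Fin.< k → P (f k)) → All P after

split : ∀ {A : Set} {n} (f : Fin n → A) (j : Fin n) → Split f j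
split f Fin.zero = record
  { before     = []
  ; after      = tabulate (f ∘ Fin.suc)
  ; tabulate≡  = refl
  ; All-before = mk⇔ (λ _ _ ()) (λ _ → [])
  ; All-after  = λ P-after → tabulate⁺ (λ k → P-after (Fin.suc k) z<s)
  }
split {A} f (Fin.suc j) = record
  { before     = f Fin.zero ∷ before
  ; after      = after
  ; tabulate≡  = cong (f Fin.zero ∷_) tabulate≡
  ; All-before = mk⇔ to from
  ; All-after  = λ P-after → All-after (λ k j<k → P-after (Fin.suc k) (s<s j<k))
  }
  where
  open Split (split (f ∘ Fin.suc) j)
  to : ∀ {P : A → Set} → All P (f Fin.zero ∷ before) → ∀ k → k Fin.< Fin.suc j → P (f k)
  to (P-first ∷ _)        Fin.zero    _     = P-first
  to (_ ∷ P-before) (Fin.suc k) k<1+j = Equivalence.to All-before P-before k (s<s⁻¹ k<1+j)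
  from : ∀ {P : A → Set} → (∀ k → k Fin.< Fin.suc j → P (f k)) → All P (f Fin.zero ∷ before)
  from P-before =
    P-before Fin.zero z<s ∷ Equivalence.from All-before (λ k k<j → P-before (Fin.suc k) (s<s k<j))

module _ {n : ℕ} (σ : Permutation′ n) where

  RLmin⇔smaller-values-left : ∀ i → RLmin σ i ⇔ (∀ k → k Fin.< σ ⟨$⟩ʳ i → σ ⟨$⟩ˡ k Fin.< i)
  RLmin⇔smaller-values-left i = mk⇔ to from
    where
    to : RLmin σ i → ∀ k → k Fin.< σ ⟨$⟩ʳ i → σ ⟨$⟩ˡ k Fin.< i
    to rl k k<σi with Fin.<-cmp (σ ⟨$⟩ˡ k) i
    ... | tri< lt _ _ = lt
    ... | tri≈ _ eq _ =
      contradiction (trans (sym (inverseʳ σ)) (cong (σ ⟨$⟩ʳ_) eq)) (Fin.<⇒≢ k<σi)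
    ... | tri> _ _ gt =
      contradiction (subst (σ ⟨$⟩ʳ i Fin.<_) (inverseʳ σ) (rl (σ ⟨$⟩ˡ k) gt)) (Fin.<-asym k<σi)
    from : (∀ k → k Fin.< σ ⟨$⟩ʳ i → σ ⟨$⟩ˡ k Fin.< i) → RLmin σ i
    from left i′ i<i′ with Fin.<-cmp (σ ⟨$⟩ʳ i′) (σ ⟨$⟩ʳ i)
    ... | tri< lt _ _ =
      contradiction (subst (Fin._< i) (inverseˡ σ) (left (σ ⟨$⟩ʳ i′) lt)) (Fin.<-asym i<i′)
    ... | tri≈ _ eq _ =
      contradiction (trans (sym (inverseˡ σ)) (trans (cong (σ ⟨$⟩ˡ_) eq) (inverseˡ σ))) (Fin.<⇒≢ i<i′ ∘ sym)
    ... | tri> _ _ gt = gt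

module _ {n : ℕ} (σ : Permutation′ n) (i : Fin n) where

  private
    column : Fin n → ℕ
    column k = toℕ (σ ⟨$⟩ˡ k)

    open Split (split column (σ ⟨$⟩ʳ i))

    column≡i⇒ : ∀ k → column k ≡ toℕ i → k ≡ σ ⟨$⟩ʳ i
    column≡i⇒ k eq = trans (sym (inverseʳ σ)) (cong (σ ⟨$⟩ʳ_) (Fin.toℕ-injective eq))

    insertion-order : map column (allFin n) ≡ before ++ toℕ i ∷ after
    insertion-order = trans (map-tabulate id column)
      (trans tabulate≡ (cong (λ c → before ++ c ∷ after) (cong toℕ (inverseˡ σ))))

    before≢i : All (_≢ toℕ i) before
    before≢i = Equivalence.from All-before λ k k<σi eq → Fin.<⇒≢ k<σi (column≡i⇒ k eq)

    after≢i : All (_≢ toℕ i) after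
    after≢i = All-after λ k σi<k eq → Fin.<⇒≢ σi<k (sym (column≡i⇒ k eq))

    groundedUp⇔before : GroundedUp (runSteps nothing (map column (allFin n)) emptyTableau) (toℕ i) ⇔
                        All (_< toℕ i) before
    groundedUp⇔before rewrite insertion-order = groundedUp⇔left-of after≢i before≢i

  RLmin⇔groundedUp : RLmin σ i ⇔ (height (φ⁻¹ σ) i ≡ 0 × rightBorder (φ⁻¹ σ) i ≡ U)
  RLmin⇔groundedUp =
    ⇔.trans (RLmin⇔smaller-values-left σ i)
    (⇔.trans (⇔.sym (All-before {P = _< toℕ i}))
    (⇔.trans (⇔.sym groundedUp⇔before)
             (⇔.refl ×-⇔ ⇔.sym (rightBorder≡U⇔rises (φ⁻¹ σ) i))))

subset-bijection : ∀ {n} {P Q : Fin n → Set} → (∀ i → P i ⇔ Q i) →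
                   Bijection (SubsetOf P) (SubsetOf Q)
subset-bijection P⇔Q = record
  { to        = λ (i , p) → i , Equivalence.to (P⇔Q i) p
  ; cong      = id
  ; bijective = id , λ (i , q) → (i , Equivalence.from (P⇔Q i) q) , id
  }

proposition12 : (n : ℕ) (σ : Permutation′ n) →
    Bijection (SubsetOf (RLmin σ))
              (SubsetOf (λ (i : Fin n) → height (φ⁻¹ σ) i ≡ 0 × rightBorder (φ⁻¹ σ) i ≡ U))
proposition12 n σ = subset-bijection (RLmin⇔groundedUp σ)
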